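{- Let $k,l$ be positive integers with $l\leq (k+3)/3$. Then for all $n$, $ex^*(n,B_{k,l})\leq \frac{k+l-2}{2}n$.
   Context: For integers $k\geq l$, the broom $B_{k,l}$ is the tree with $k$ edges formed by the disjoint union of a path $P_{l-1}$ (with $l-1$ edges) and a star $K_{1,k-l}$, together with one edge joining an endpoint of the path to the centre of the star. An edge coloring is proper if edges sharing a vertex get different colors; a subgraph is rainbow if all its edges have distinct colors. $ex^*(n,F)$ is the maximum number of edges in a properly edge-colored $n$-vertex graph with no rainbow copy of $F$. -}

module Defs where

open import Data.Bool using (Bool; true; false; if_then_else_; _∧_)
open import Data.Nat using (ℕ; zero; suc; _+_; _*_; _∸_; _≤_; _<_; _⊓_; _<ᵇ_)
open import Data.Fin using (Fin; toℕ) renaming (zero to fz; suc to fs)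
open import Data.Product using (_×_; Σ)
open import Relation.Binary.PropositionalEquality using (_≡_; _≢_)

record Graph (n : ℕ) : Set where
  field
    Adj   : Fin n → Fin n → Bool
    sym   : ∀ u v → Adj u v ≡ Adj v u
    irrefl : ∀ u → Adj u u ≡ false
open Graph public

Σfin : ∀ {n} → (Fin n → ℕ) → ℕ
Σfin {zero}  f = 0
Σfin {suc n} f = f fz + Σfin (λ i → f (fs i))

edgeCount : ∀ {n} → Graph n → ℕ
edgeCount G = Σfin (λ u → Σfin (λ v →
  if (toℕ u <ᵇ toℕ v) ∧ Adj G u v then 1 else 0))

-- An edge colouring (colours are natural numbers); only its values on edges
-- matter. It must be well defined on edges (symmetric) and proper.
record ProperColouring {n : ℕ} (G : Graph n) : Set where
  field
    col    : Fin n → Fin n → ℕ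
    col-sym : ∀ u v → Adj G u v ≡ true → col u v ≡ col v u
    proper : ∀ u v w → Adj G u v ≡ true → Adj G u w ≡ true → v ≢ w →
             col u v ≢ col u w
open ProperColouring public

-- The broom B_{k,l} on vertices 0..k: for each edge index e < k, edge e joins
-- vertex (e ⊓ l) and vertex (e+1).  For e < l these are the path edges
-- 0-1-…-l (the path P_{l-1} on vertices 0..l-1 plus the joining edge to the
-- centre l); for l ≤ e < k these are the star edges l-(e+1), e+1 = l+1..k.
broomLo : ℕ → ℕ → ℕ
broomLo l e = e ⊓ l

broomHi : ℕ → ℕ
broomHi e = suc e

record RainbowBroom {n : ℕ} (G : Graph n) (c : ProperColouring G) (k l : ℕ) : Set where
  field
    f      : ℕ → Fin n
    inj    : ∀ i j → i ≤ k → j ≤ k → f i ≡ f j → i ≡ j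
    edges  : ∀ e → e < k → Adj G (f (broomLo l e)) (f (broomHi e)) ≡ true
    rainbow : ∀ e e' → e < k → e' < k →
              col c (f (broomLo l e)) (f (broomHi e)) ≡ col c (f (broomLo l e')) (f (broomHi e')) →
              e ≡ e'

module Submission where

-- Write D = k + l - 2. The argument is a degeneracy induction on n. If some vertex has
-- degree at most D/2, delete it: the degree sum drops by at most D, and a rainbow broom in
-- the smaller graph is one in G. Otherwise every degree exceeds D/2 ≥ 2l - 3. If now some
-- vertex v has degree above D, a rainbow B_{k,l} is built greedily: starting at v, first
-- the path of length l, then the k - l star leaves at v. Each new vertex is chosen among
-- the neighbours of its parent; the forbidden choices are the earlier vertices not
-- adjacent to the parent in the broom, and the at most one neighbour per colour already
-- used (properness), and the degree bounds leave a free choice. Hence all degrees are at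
-- most D, which gives the bound. Finally 2 e(G) is the degree sum (handshake lemma).

open import Defs hiding (sym)
open import Data.Bool using (Bool; true; false; if_then_else_; _∧_)
import Data.Bool as Bool
open import Data.Bool.Properties using (T-≡; ¬-not)
open import Data.Fin using (Fin; toℕ; punchIn) renaming (zero to fzero; suc to fsuc)
import Data.Fin.Properties as Fin
open import Data.Fin.Properties using (punchIn-injective; any?; toℕ-injective)
open import Data.Nat
open import Data.Nat.Properties
open import Data.Nat.Tactic.RingSolver using (solve-∀)
open import Data.Product using (_×_; _,_; proj₁; proj₂; ∃)
open import Data.Sum using (_⊎_; inj₁; inj₂; [_,_]′; map₁)
open import Function using (_∘_)
open import Function.Bundles using (Equivalence)
open import Level using (0ℓ)
open import Relation.Binary using (tri<; tri≈; tri>)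
open import Relation.Binary.PropositionalEquality
open import Relation.Nullary using (¬_; Dec; yes; no; ¬?; contradiction; _×-dec_)
open import Relation.Unary using (Pred; Decidable; _∩_; ∁)
open import Relation.Unary.Properties using (_∩?_; ∁?)
open import Algebra.Properties.Semiring.Sum +-*-semiring
  using (sum; sum-cong-≗; ∑-distrib-+; ∑-comm; sum-remove)

𝟙 : ∀ {P : Set} → Dec P → ℕ
𝟙 (yes _) = 1
𝟙 (no _)  = 0

count : ∀ {n} {P : Pred (Fin n) 0ℓ} → Decidable P → ℕ
count P? = sum (λ w → 𝟙 (P? w))

sum-mono : ∀ {n} {f g : Fin n → ℕ} → (∀ i → f i ≤ g i) → sum f ≤ sum g
sum-mono {zero}  f≤g = z≤n
sum-mono {suc n} f≤g = +-mono-≤ (f≤g fzero) (sum-mono (f≤g ∘ fsuc))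

AtMostOne : ∀ {n} → Pred (Fin n) 0ℓ → Set
AtMostOne P = ∀ {w w′} → P w → P w′ → w ≡ w′

𝟙-mono : ∀ {P Q : Set} → (P → Q) → (p : Dec P) (q : Dec Q) → 𝟙 p ≤ 𝟙 q
𝟙-mono P⇒Q (yes p) (yes q) = ≤-refl
𝟙-mono P⇒Q (yes p) (no ¬q) = contradiction (P⇒Q p) ¬q
𝟙-mono P⇒Q (no ¬p) q       = z≤n

count-mono : ∀ {n} {P Q : Pred (Fin n) 0ℓ} (P? : Decidable P) (Q? : Decidable Q) →
             (∀ {w} → P w → Q w) → count P? ≤ count Q?
count-mono P? Q? P⊆Q = sum-mono (λ w → 𝟙-mono P⊆Q (P? w) (Q? w))

𝟙-split : ∀ {P B : Set} (p : Dec P) (b : Dec B) →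
          𝟙 p ≤ 𝟙 (p ×-dec ¬? b) + 𝟙 (p ×-dec b)
𝟙-split (yes _) (yes _) = ≤-refl
𝟙-split (yes _) (no _)  = ≤-refl
𝟙-split (no _)  b       = z≤n

count-positive : ∀ {n} {P : Pred (Fin n) 0ℓ} (P? : Decidable P) → 0 < count P? → ∃ P
count-positive {suc n} P? pos with P? fzero
... | yes p = fzero , p
... | no _  with count-positive (P? ∘ fsuc) pos
...   | w , p = fsuc w , p

count-none : ∀ {n} {P : Pred (Fin n) 0ℓ} (P? : Decidable P) → (∀ w → ¬ P w) → count P? ≡ 0
count-none {zero}  P? none = refl
count-none {suc n} P? none with P? fzero
... | yes p = contradiction p (none fzero)
... | no _  = count-none (P? ∘ fsuc) (none ∘ fsuc)

count-atMostOne : ∀ {n} {P : Pred (Fin n) 0ℓ} (P? : Decidable P) → AtMostOne P → count P? ≤ 1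
count-atMostOne {zero}  P? unique = z≤n
count-atMostOne {suc n} P? unique with P? fzero
... | yes p = ≤-reflexive (cong suc (count-none (P? ∘ fsuc) (λ w p′ → Fin.0≢1+n (unique p p′))))
... | no _  = count-atMostOne (P? ∘ fsuc) (λ p p′ → Fin.suc-injective (unique p p′))

count-remove-one : ∀ {n} {P B : Pred (Fin n) 0ℓ} (P? : Decidable P) (B? : Decidable B) →
                   AtMostOne (P ∩ B) → count P? ≤ count (P? ∩? ∁? B?) + 1
count-remove-one P? B? unique = begin
  count P?                               ≤⟨ sum-mono (λ w → 𝟙-split (P? w) (B? w)) ⟩
  sum (λ w → 𝟙 (Kept? w) + 𝟙 (Lost? w))  ≡⟨ ∑-distrib-+ (λ w → 𝟙 (Kept? w)) (λ w → 𝟙 (Lost? w)) ⟩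
  count Kept? + count Lost?              ≤⟨ +-monoʳ-≤ (count Kept?) (count-atMostOne Lost? unique) ⟩
  count Kept? + 1                        ∎
  where
  open ≤-Reasoning
  Kept? = P? ∩? ∁? B?
  Lost? = P? ∩? B?

Avoids : ∀ {n} → (ℕ → Pred (Fin n) 0ℓ) → ℕ → Pred (Fin n) 0ℓ
Avoids R L w = ∀ {t} → t < L → ¬ R t w

avoids? : ∀ {n} {R : ℕ → Pred (Fin n) 0ℓ} → (∀ t → Decidable (R t)) → ∀ L → Decidable (Avoids R L)
avoids? R? L w = allUpTo? (λ t → ¬? (R? t w)) L

count-avoids : ∀ {n} {P : Pred (Fin n) 0ℓ} {R : ℕ → Pred (Fin n) 0ℓ} →
               (P? : Decidable P) (R? : ∀ t → Decidable (R t)) →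
               ∀ L → (∀ {t} → t < L → AtMostOne (P ∩ R t)) →
               count P? ≤ count (P? ∩? avoids? R? L) + L
count-avoids P? R? zero unique =
  ≤-trans (count-mono P? (P? ∩? avoids? R? 0) (λ p → p , λ ())) (m≤m+n _ 0)
count-avoids {P = P} {R} P? R? (suc L) unique = begin
  count P?                                          ≤⟨ count-avoids P? R? L (unique ∘ m≤n⇒m≤1+n) ⟩
  count A? + L                                      ≤⟨ +-monoˡ-≤ L (count-remove-one A? (R? L) uniqueA) ⟩
  count (A? ∩? ∁? (R? L)) + 1 + L                   ≤⟨ +-monoˡ-≤ L (+-monoˡ-≤ 1 (count-mono (A? ∩? ∁? (R? L)) (P? ∩? avoids? R? (suc L)) survives)) ⟩
  count (P? ∩? avoids? R? (suc L)) + 1 + L          ≡⟨ +-assoc _ 1 L ⟩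
  count (P? ∩? avoids? R? (suc L)) + suc L          ∎
  where
  open ≤-Reasoning
  A? = P? ∩? avoids? R? L
  uniqueA : AtMostOne ((P ∩ Avoids R L) ∩ R L)
  uniqueA ((p , _) , r) ((p′ , _) , r′) = unique ≤-refl (p , r) (p′ , r′)
  survives : ∀ {w} → ((P ∩ Avoids R L) ∩ ∁ (R L)) w → (P ∩ Avoids R (suc L)) w
  survives ((p , avoid) , ¬r) = p , λ t<1+L → [ avoid , (λ { refl → ¬r }) ]′ (m≤n⇒m<n∨m≡n (s≤s⁻¹ t<1+L))

ι : Bool → ℕ
ι b = if b then 1 else 0

deg : ∀ {n} → Graph n → Fin n → ℕ
deg G u = sum (λ w → ι (Adj G u w))

𝟙-≟-true : ∀ b → 𝟙 (b Bool.≟ true) ≡ ι b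
𝟙-≟-true true  = refl
𝟙-≟-true false = refl

degreeSum : ∀ {n} → Graph n → ℕ
degreeSum G = sum (deg G)

Σfin≡sum : ∀ {n} (f : Fin n → ℕ) → Σfin f ≡ sum f
Σfin≡sum {zero}  f = refl
Σfin≡sum {suc n} f = cong (f fzero +_) (Σfin≡sum (f ∘ fsuc))

-- Every edge {u,v} is counted once by edgeCount, namely at the ordered pair with toℕ u < toℕ v.
module _ {n} (G : Graph n) where

  private
    forward : Fin n → Fin n → ℕ
    forward u v = ι ((toℕ u <ᵇ toℕ v) ∧ Adj G u v)

    <ᵇ-false : ∀ {a b} → b ≤ a → (a <ᵇ b) ≡ false
    <ᵇ-false {a} {b} b≤a = ¬-not (λ a<ᵇb → ≤⇒≯ b≤a (<ᵇ⇒< a b (Equivalence.from T-≡ a<ᵇb)))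

    <ᵇ-true : ∀ {a b} → a < b → (a <ᵇ b) ≡ true
    <ᵇ-true a<b = Equivalence.to T-≡ (<⇒<ᵇ a<b)

    adjacency-split : ∀ u v → ι (Adj G u v) ≡ forward u v + forward v u
    adjacency-split u v with <-cmp (toℕ u) (toℕ v)
    ... | tri< u<v _ _ rewrite <ᵇ-true u<v | <ᵇ-false (<⇒≤ u<v) = sym (+-identityʳ _)
    ... | tri> _ _ v<u rewrite <ᵇ-true v<u | <ᵇ-false (<⇒≤ v<u) = cong ι (Graph.sym G u v)
    ... | tri≈ _ u≡v _ rewrite toℕ-injective u≡v | <ᵇ-false (≤-refl {toℕ v}) = cong ι (irrefl G v)

  handshake : degreeSum G ≡ 2 * edgeCount G
  handshake = begin
    sum (λ u → sum (λ v → ι (Adj G u v)))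
      ≡⟨ sum-cong-≗ (λ u → sum-cong-≗ (adjacency-split u)) ⟩
    sum (λ u → sum (λ v → forward u v + forward v u))
      ≡⟨ sum-cong-≗ (λ u → ∑-distrib-+ (forward u) (λ v → forward v u)) ⟩
    sum (λ u → sum (forward u) + sum (λ v → forward v u))
      ≡⟨ ∑-distrib-+ (λ u → sum (forward u)) (λ u → sum (λ v → forward v u)) ⟩
    E + sum (λ u → sum (λ v → forward v u))
      ≡⟨ cong (E +_) (∑-comm (λ u v → forward v u)) ⟩
    E + E
      ≡⟨ cong (E +_) (sym (+-identityʳ E)) ⟩
    2 * E
      ≡⟨ cong (2 *_) (sym edgeCount≡E) ⟩
    2 * edgeCount G ∎
    where
    open ≡-Reasoning
    E = sum (λ u → sum (forward u))
    edgeCount≡E : edgeCount G ≡ E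
    edgeCount≡E = trans (Σfin≡sum (λ u → Σfin (forward u))) (sum-cong-≗ (λ u → Σfin≡sum (forward u)))

_∖_ : ∀ {n} → Graph (suc n) → Fin (suc n) → Graph n
G ∖ i = record
  { Adj    = λ u v → Adj G (punchIn i u) (punchIn i v)
  ; sym    = λ u v → Graph.sym G (punchIn i u) (punchIn i v)
  ; irrefl = λ u → irrefl G (punchIn i u)
  }

restrict : ∀ {n} {G : Graph (suc n)} → ProperColouring G → (i : Fin (suc n)) → ProperColouring (G ∖ i)
restrict c i = record
  { col     = λ u v → col c (punchIn i u) (punchIn i v)
  ; col-sym = λ u v → col-sym c (punchIn i u) (punchIn i v)
  ; proper  = λ u v w uv uw v≢w → proper c _ _ _ uv uw (v≢w ∘ punchIn-injective i v w)
  }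

liftBroom : ∀ {n} {G : Graph (suc n)} {c : ProperColouring G} {k l} (i : Fin (suc n)) →
            RainbowBroom (G ∖ i) (restrict c i) k l → RainbowBroom G c k l
liftBroom i B = record
  { f       = punchIn i ∘ f
  ; inj     = λ a b a≤k b≤k eq → inj a b a≤k b≤k (punchIn-injective i _ _ eq)
  ; edges   = edges
  ; rainbow = rainbow
  }
  where open RainbowBroom B

degreeSum-delete : ∀ {n} (G : Graph (suc n)) (i : Fin (suc n)) →
                   degreeSum G ≡ 2 * deg G i + degreeSum (G ∖ i)
degreeSum-delete G i = begin
  degreeSum G
    ≡⟨ sum-remove (deg G) ⟩
  deg G i + sum (λ a → deg G (punchIn i a))
    ≡⟨ cong (deg G i +_) (sum-cong-≗ (λ a → sum-remove (λ w → ι (Adj G (punchIn i a) w)))) ⟩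
  deg G i + sum (λ a → ι (Adj G (punchIn i a) i) + deg (G ∖ i) a)
    ≡⟨ cong (deg G i +_) (∑-distrib-+ (λ a → ι (Adj G (punchIn i a) i)) (deg (G ∖ i))) ⟩
  deg G i + (sum (λ a → ι (Adj G (punchIn i a) i)) + degreeSum (G ∖ i))
    ≡⟨ cong (λ d → deg G i + (d + degreeSum (G ∖ i))) edges-to-i ⟩
  deg G i + (deg G i + degreeSum (G ∖ i))
    ≡⟨ sym (+-assoc (deg G i) (deg G i) _) ⟩
  deg G i + deg G i + degreeSum (G ∖ i)
    ≡⟨ cong (λ d → deg G i + d + degreeSum (G ∖ i)) (sym (+-identityʳ (deg G i))) ⟩
  2 * deg G i + degreeSum (G ∖ i) ∎
  where
  open ≡-Reasoning
  -- the edges from the other vertices to i are exactly the edges at i, as i has no loop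
  edges-to-i : sum (λ a → ι (Adj G (punchIn i a) i)) ≡ deg G i
  edges-to-i = begin
    sum (λ a → ι (Adj G (punchIn i a) i))  ≡⟨ sum-cong-≗ (λ a → cong ι (Graph.sym G (punchIn i a) i)) ⟩
    sum (λ a → ι (Adj G i (punchIn i a)))  ≡⟨ cong (λ b → ι b + sum (λ a → ι (Adj G i (punchIn i a)))) (sym (irrefl G i)) ⟩
    ι (Adj G i i) + sum (λ a → ι (Adj G i (punchIn i a))) ≡⟨ sum-remove (λ w → ι (Adj G i w)) ⟨
    deg G i ∎

sum-bounded : ∀ {n} (f : Fin n → ℕ) {D} → (∀ i → f i ≤ D) → sum f ≤ D * n
sum-bounded {zero}  f {D} f≤D = z≤n
sum-bounded {suc n} f {D} f≤D =
  ≤-trans (+-mono-≤ (f≤D fzero) (sum-bounded (f ∘ fsuc) (f≤D ∘ fsuc))) (≤-reflexive (sym (*-suc D n)))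

-- Let H be a property of coloured graphs that survives adding a vertex, and is forced
-- whenever some degree exceeds D while all degrees exceed D/2. Then every coloured
-- graph without H has degree sum at most D n: repeatedly delete a vertex of degree
-- at most D/2; once none is left, H being absent forces every degree to be at most D.
module Degeneracy
  (H : ∀ {n} (G : Graph n) → ProperColouring G → Set)
  (H-lift : ∀ {n} {G : Graph (suc n)} {c : ProperColouring G} (i : Fin (suc n)) →
            H (G ∖ i) (restrict c i) → H G c)
  (D : ℕ)
  (H-forced : ∀ {n} (G : Graph n) (c : ProperColouring G) (v : Fin n) →
              D < deg G v → (∀ u → D < 2 * deg G u) → H G c)
  where

  degreeSum-bound : ∀ n (G : Graph n) (c : ProperColouring G) → ¬ H G c → degreeSum G ≤ D * n
  degreeSum-bound zero    G c ¬H = z≤n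
  degreeSum-bound (suc n) G c ¬H with any? (λ i → 2 * deg G i ≤? D)
  ... | yes (i , low) = begin
    degreeSum G                      ≡⟨ degreeSum-delete G i ⟩
    2 * deg G i + degreeSum (G ∖ i)  ≤⟨ +-mono-≤ low (degreeSum-bound n (G ∖ i) (restrict c i) (¬H ∘ H-lift i)) ⟩
    D + D * n                        ≡⟨ *-suc D n ⟨
    D * suc n                        ∎
    where open ≤-Reasoning
  ... | no noLow with any? (λ v → D <? deg G v)
  ...   | yes (v , high) = contradiction (H-forced G c v high (λ u → ≰⇒> (noLow ∘ (u ,_)))) ¬H
  ...   | no noHigh      = sum-bounded (deg G) (λ v → ≮⇒≥ (noHigh ∘ (v ,_)))

InjectiveOn : {A : Set} → (ℕ → A) → ℕ → ℕ → Set
InjectiveOn g lo m = ∀ {i j} → lo ≤ i → lo ≤ j → i ≤ m → j ≤ m → g i ≡ g j → i ≡ j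

old-or-new : ∀ {j m} → j ≤ suc m → j ≤ m ⊎ j ≡ suc m
old-or-new j≤1+m = map₁ s≤s⁻¹ (m≤n⇒m<n∨m≡n j≤1+m)

injectiveOn-cong : ∀ {A : Set} {g g′ : ℕ → A} {lo m} → InjectiveOn g lo m →
                   (∀ {j} → lo ≤ j → j ≤ m → g′ j ≡ g j) → InjectiveOn g′ lo m
injectiveOn-cong inj g′≡g lo≤i lo≤j i≤m j≤m eq =
  inj lo≤i lo≤j i≤m j≤m (trans (sym (g′≡g lo≤i i≤m)) (trans eq (g′≡g lo≤j j≤m)))

injectiveOn-extend : ∀ {A : Set} {g : ℕ → A} {lo m} → InjectiveOn g lo m →
                     (∀ {j} → lo ≤ j → j ≤ m → g (suc m) ≢ g j) → InjectiveOn g lo (suc m)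
injectiveOn-extend inj new lo≤i lo≤j i≤ j≤ eq with old-or-new i≤ | old-or-new j≤
... | inj₁ i≤m  | inj₁ j≤m  = inj lo≤i lo≤j i≤m j≤m eq
... | inj₁ i≤m  | inj₂ refl = contradiction (sym eq) (new lo≤i i≤m)
... | inj₂ refl | inj₁ j≤m  = contradiction eq (new lo≤j j≤m)
... | inj₂ refl | inj₂ refl = refl

_[_↦_] : {A : Set} → (ℕ → A) → ℕ → A → ℕ → A
(x [ m ↦ w ]) j with j ≟ m
... | yes _ = w
... | no  _ = x j

place-new : ∀ {A : Set} (x : ℕ → A) m w → (x [ m ↦ w ]) m ≡ w
place-new x m w with m ≟ m
... | yes _  = refl
... | no m≢m = contradiction refl m≢m

place-old : ∀ {A : Set} (x : ℕ → A) {m} w {j} → j < m → (x [ m ↦ w ]) j ≡ x j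
place-old x {m} w {j} j<m with j ≟ m
... | yes j≡m = contradiction j≡m (<⇒≢ j<m)
... | no  _   = refl

-- The tree has vertices 0, 1, 2, ... with root 0; each j ≥ 1 hangs below par j < j.
-- Vertices are placed in the order 0, 1, 2, ..., the root at r.
module TreeEmbedding {n : ℕ} (G : Graph n) (c : ProperColouring G)
  (par : ℕ → ℕ) (par< : ∀ {j} → 1 ≤ j → par j < j) (r : Fin n) where

  treeColour : (ℕ → Fin n) → ℕ → ℕ
  treeColour x j = col c (x (par j)) (x j)

  record RainbowEmbedding (m : ℕ) (x : ℕ → Fin n) : Set where
    field
      root      : x 0 ≡ r
      injective : InjectiveOn x 0 m
      adjacent  : ∀ {j} → 1 ≤ j → j ≤ m → Adj G (x (par j)) (x j) ≡ true
      rainbow   : InjectiveOn (treeColour x) 1 m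

  rootOnly : RainbowEmbedding 0 (λ _ → r)
  rootOnly = record
    { root      = refl
    ; injective = λ { _ _ z≤n z≤n _ → refl }
    ; adjacent  = λ { (s≤s _) () }
    ; rainbow   = λ { (s≤s _) _ () _ _ }
    }

  extend : ∀ {m x} → RainbowEmbedding m x → (w : Fin n) →
           Adj G (x (par (suc m))) w ≡ true →
           (∀ {j} → j ≤ m → w ≢ x j) →
           (∀ {j} → 1 ≤ j → j ≤ m → col c (x (par (suc m))) w ≢ treeColour x j) →
           RainbowEmbedding (suc m) (x [ suc m ↦ w ])
  extend {m} {x} E w adj fresh newColour = record
    { root      = trans (old z≤n) root
    ; injective = injectiveOn-extend (injectiveOn-cong injective (λ _ → old))
                    (λ _ j≤m eq → fresh j≤m (trans (sym (place-new x (suc m) w)) (trans eq (old j≤m))))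
    ; adjacent  = adjacent′
    ; rainbow   = injectiveOn-extend (injectiveOn-cong rainbow colour-old)
                    (λ 1≤j j≤m eq → newColour 1≤j j≤m (trans (sym colour-new) (trans eq (colour-old 1≤j j≤m))))
    }
    where
    open RainbowEmbedding E
    x′ : ℕ → Fin n
    x′ = x [ suc m ↦ w ]
    old : ∀ {j} → j ≤ m → x′ j ≡ x j
    old j≤m = place-old x w (s≤s j≤m)
    par≤m : ∀ {j} → 1 ≤ j → j ≤ suc m → par j ≤ m
    par≤m 1≤j j≤1+m = s≤s⁻¹ (≤-trans (par< 1≤j) j≤1+m)
    colour-old : ∀ {j} → 1 ≤ j → j ≤ m → treeColour x′ j ≡ treeColour x j
    colour-old 1≤j j≤m = cong₂ (col c) (old (par≤m 1≤j (m≤n⇒m≤1+n j≤m))) (old j≤m)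
    colour-new : treeColour x′ (suc m) ≡ col c (x (par (suc m))) w
    colour-new = cong₂ (col c) (old (par≤m (s≤s z≤n) ≤-refl)) (place-new x (suc m) w)
    adjacent′ : ∀ {j} → 1 ≤ j → j ≤ suc m → Adj G (x′ (par j)) (x′ j) ≡ true
    adjacent′ {j} 1≤j j≤1+m with old-or-new j≤1+m
    ... | inj₁ j≤m  = trans (cong₂ (Adj G) (old (par≤m 1≤j j≤1+m)) (old j≤m)) (adjacent 1≤j j≤m)
    ... | inj₂ refl = trans (cong₂ (Adj G) (old (par≤m 1≤j j≤1+m)) (place-new x (suc m) w)) adj

  data Covered (p a L j : ℕ) : Set where
    self   : j ≡ p → Covered p a L j
    parent : 1 ≤ p → j ≡ par p → Covered p a L j
    child  : 1 ≤ j → par j ≡ p → Covered p a L j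
    listed : ∀ t → t < L → j ≡ a + t → Covered p a L j

  -- A neighbour w of x p avoiding the listed vertices, with an edge colour not yet used,
  -- is distinct from every covered vertex: G has no loops, and a tree neighbour of p
  -- would give the edge p w an already used colour.
  fresh : ∀ {m x} → RainbowEmbedding m x → ∀ {p a L w} → p ≤ m → Adj G (x p) w ≡ true →
          (∀ {t} → t < L → w ≢ x (a + t)) →
          (∀ {j} → 1 ≤ j → j ≤ m → col c (x p) w ≢ treeColour x j) →
          ∀ {j} → j ≤ m → Covered p a L j → w ≢ x j
  fresh {x = x} E {p} p≤m adj unlisted newColour _ (self refl) refl =
    contradiction (trans (sym adj) (irrefl G (x p))) λ ()
  fresh {x = x} E {p} p≤m adj unlisted newColour _ (parent 1≤p refl) refl =
    newColour 1≤p p≤m (col-sym c (x p) (x (par p)) adj)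
  fresh E p≤m adj unlisted newColour j≤m (child 1≤j refl) refl = newColour 1≤j j≤m refl
  fresh E p≤m adj unlisted newColour _ (listed t t<L refl) refl = unlisted t<L refl

  -- A vertex u with more than L + m neighbours has a neighbour w avoiding L listed vertices
  -- such that uw has none of the colours of tree edges 1..m: each listed vertex excludes
  -- one neighbour, and by properness each used colour excludes at most one neighbour.
  findNeighbour : ∀ m (x : ℕ → Fin n) u a L → L + m < deg G u →
                  ∃ λ w → Adj G u w ≡ true × (∀ {t} → t < L → w ≢ x (a + t)) ×
                          (∀ {j} → 1 ≤ j → j ≤ m → col c u w ≢ treeColour x j)
  findNeighbour m x u a L big with count-positive Survivor? (positive big neighbours)
    where
    Neighbour : Pred (Fin n) 0ℓ
    Neighbour w = Adj G u w ≡ true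
    Listed Clash : ℕ → Pred (Fin n) 0ℓ
    Listed t w = w ≡ x (a + t)
    Clash t w = col c u w ≡ treeColour x (suc t)
    Neighbour? : Decidable Neighbour
    Neighbour? w = Adj G u w Bool.≟ true
    Listed? : ∀ t → Decidable (Listed t)
    Listed? t w = w Fin.≟ x (a + t)
    Clash? : ∀ t → Decidable (Clash t)
    Clash? t w = col c u w ≟ treeColour x (suc t)
    Unlisted? : Decidable (Neighbour ∩ Avoids Listed L)
    Unlisted? = Neighbour? ∩? avoids? Listed? L
    Survivor? : Decidable ((Neighbour ∩ Avoids Listed L) ∩ Avoids Clash m)
    Survivor? = Unlisted? ∩? avoids? Clash? m
    one-per-colour : ∀ t {w w′} → Neighbour w → Neighbour w′ → Clash t w → Clash t w′ → w ≡ w′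
    one-per-colour t {w} {w′} uw uw′ cw cw′ with w Fin.≟ w′
    ... | yes w≡w′ = w≡w′
    ... | no  w≢w′ = contradiction (trans cw (sym cw′)) (proper c u w w′ uw uw′ w≢w′)
    neighbours : deg G u ≤ count Survivor? + m + L
    neighbours = begin
      deg G u                    ≡⟨ sum-cong-≗ (λ w → 𝟙-≟-true (Adj G u w)) ⟨
      count Neighbour?           ≤⟨ count-avoids Neighbour? Listed? L (λ { _ (_ , refl) (_ , refl) → refl }) ⟩
      count Unlisted? + L        ≤⟨ +-monoˡ-≤ L (count-avoids Unlisted? Clash? m
                                      (λ {t} _ ((uw , _) , cw) ((uw′ , _) , cw′) → one-per-colour t uw uw′ cw cw′)) ⟩
      count Survivor? + m + L    ∎
      where open ≤-Reasoning
    positive : ∀ {s} → L + m < s → s ≤ count Survivor? + m + L → 0 < count Survivor?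
    positive {s} big s≤ with count Survivor?
    ... | suc _ = z<s
    ... | zero  = contradiction (≤-trans s≤ (≤-reflexive (+-comm m L))) (<⇒≱ big)
  ... | w , ((uw , unlisted) , newColour) =
    w , uw , unlisted , λ { {suc t} _ j≤m → newColour j≤m }

  grow : ∀ {m x} → RainbowEmbedding m x → ∀ {p a L} → par (suc m) ≡ p →
         (∀ {j} → j ≤ m → Covered p a L j) → L + m < deg G (x p) →
         ∃ (RainbowEmbedding (suc m))
  grow {m} {x} E {a = a} {L} refl covered big with findNeighbour m x (x (par (suc m))) a L big
  ... | w , uw , unlisted , newColour =
    x [ suc m ↦ w ] , extend E w uw (λ j≤m → fresh E p≤m uw unlisted newColour j≤m (covered j≤m)) newColour
    where
    p≤m : par (suc m) ≤ m
    p≤m = s≤s⁻¹ (par< z<s)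

-- Tree vertex 0 is the centre, 1..l is the handle (j hangs below j-1, so l is the far
-- end of the path), and l+1..k are the leaves of the star, hanging below 0.
module CentredBroom (k l : ℕ) where

  par : ℕ → ℕ
  par j with j ≤? l
  ... | yes _ = pred j
  ... | no  _ = 0

  par-handle : ∀ {j} → j ≤ l → par j ≡ pred j
  par-handle {j} j≤l with j ≤? l
  ... | yes _   = refl
  ... | no  j≰l = contradiction j≤l j≰l

  par-leaf : ∀ {j} → l < j → par j ≡ 0
  par-leaf {j} l<j with j ≤? l
  ... | yes j≤l = contradiction j≤l (<⇒≱ l<j)
  ... | no  _   = refl

  par< : ∀ {j} → 1 ≤ j → par j < j
  par< {suc j} _ with suc j ≤? l
  ... | yes _ = ≤-refl
  ... | no  _ = z<s

  -- σ sends broom vertex i (path 0..l with centre l, leaves l+1..k) to its tree vertex.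
  σ : ℕ → ℕ
  σ i with i ≤? l
  ... | yes _ = l ∸ i
  ... | no  _ = i

  σ-handle : ∀ {i} → i ≤ l → σ i ≡ l ∸ i
  σ-handle {i} i≤l with i ≤? l
  ... | yes _   = refl
  ... | no  i≰l = contradiction i≤l i≰l

  σ-leaf : ∀ {i} → l < i → σ i ≡ i
  σ-leaf {i} l<i with i ≤? l
  ... | yes i≤l = contradiction i≤l (<⇒≱ l<i)
  ... | no  _   = refl

  σ-involutive : ∀ i → σ (σ i) ≡ i
  σ-involutive i with i ≤? l
  ... | yes i≤l = trans (σ-handle (m∸n≤m l i)) (m∸[m∸n]≡n i≤l)
  ... | no  i≰l = σ-leaf (≰⇒> i≰l)

  σ-injective : ∀ {i j} → σ i ≡ σ j → i ≡ j
  σ-injective {i} {j} eq = trans (sym (σ-involutive i)) (trans (cong σ eq) (σ-involutive j))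

  σ≤k : l ≤ k → ∀ {i} → i ≤ k → σ i ≤ k
  σ≤k l≤k {i} i≤k with i ≤? l
  ... | yes _ = ≤-trans (m∸n≤m l i) l≤k
  ... | no  _ = i≤k

  -- The endpoint of broom edge e farther from the centre, and its tree vertex τ e.
  tip : ℕ → ℕ
  tip e with e <? l
  ... | yes _ = e
  ... | no  _ = suc e

  τ : ℕ → ℕ
  τ e = σ (tip e)

  tip-handle : ∀ {e} → e < l → tip e ≡ e
  tip-handle {e} e<l with e <? l
  ... | yes _   = refl
  ... | no  e≮l = contradiction e<l e≮l

  tip-leaf : ∀ {e} → l ≤ e → tip e ≡ suc e
  tip-leaf {e} l≤e with e <? l
  ... | yes e<l = contradiction e<l (≤⇒≯ l≤e)
  ... | no  _   = refl

  τ-handle : ∀ {e} → e < l → τ e ≡ l ∸ e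
  τ-handle e<l = trans (cong σ (tip-handle e<l)) (σ-handle (<⇒≤ e<l))

  τ-leaf : ∀ {e} → l ≤ e → τ e ≡ suc e
  τ-leaf l≤e = trans (cong σ (tip-leaf l≤e)) (σ-leaf (s≤s l≤e))

  tip-injective : ∀ {e e′} → tip e ≡ tip e′ → e ≡ e′
  tip-injective {e} {e′} eq with <-≤-connex e l | <-≤-connex e′ l
  ... | inj₁ e<l | inj₁ e′<l = trans (sym (tip-handle e<l)) (trans eq (tip-handle e′<l))
  ... | inj₂ l≤e | inj₂ l≤e′ = suc-injective (trans (sym (tip-leaf l≤e)) (trans eq (tip-leaf l≤e′)))
  ... | inj₁ e<l | inj₂ l≤e′ =
    contradiction (trans (sym (tip-handle e<l)) (trans eq (tip-leaf l≤e′))) (<⇒≢ (<-≤-trans e<l (m≤n⇒m≤1+n l≤e′)))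
  ... | inj₂ l≤e | inj₁ e′<l =
    contradiction (trans (sym (tip-handle e′<l)) (trans (sym eq) (tip-leaf l≤e))) (<⇒≢ (<-≤-trans e′<l (m≤n⇒m≤1+n l≤e)))

  τ-injective : ∀ {e e′} → τ e ≡ τ e′ → e ≡ e′
  τ-injective = tip-injective ∘ σ-injective

  broom-edge : ∀ e → (σ (broomLo l e) ≡ τ e × σ (broomHi e) ≡ par (τ e))
                   ⊎ (σ (broomLo l e) ≡ par (τ e) × σ (broomHi e) ≡ τ e)
  broom-edge e with <-≤-connex e l
  ... | inj₁ e<l = inj₁ (trans (cong σ (m≤n⇒m⊓n≡m (<⇒≤ e<l))) (cong σ (sym (tip-handle e<l))) , (begin
    σ (suc e)         ≡⟨ σ-handle e<l ⟩
    l ∸ suc e         ≡⟨ pred[m∸n]≡m∸[1+n] l e ⟨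
    pred (l ∸ e)      ≡⟨ par-handle (m∸n≤m l e) ⟨
    par (l ∸ e)       ≡⟨ cong par (τ-handle e<l) ⟨
    par (τ e)         ∎))
    where open ≡-Reasoning
  ... | inj₂ l≤e = inj₂ ((begin
    σ (e ⊓ l)         ≡⟨ cong σ (m≥n⇒m⊓n≡n l≤e) ⟩
    σ l               ≡⟨ σ-handle ≤-refl ⟩
    l ∸ l             ≡⟨ n∸n≡0 l ⟩
    0                 ≡⟨ par-leaf (s≤s l≤e) ⟨
    par (suc e)       ≡⟨ cong par (τ-leaf l≤e) ⟨
    par (τ e)         ∎) , cong σ (sym (tip-leaf l≤e)))
    where open ≡-Reasoning

  τ-range : l ≤ k → ∀ {e} → e < k → 1 ≤ τ e × τ e ≤ k
  τ-range l≤k {e} e<k with <-≤-connex e l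
  ... | inj₁ e<l = subst (1 ≤_) (sym (τ-handle e<l)) (m<n⇒0<n∸m e<l) , subst (_≤ k) (sym (τ-handle e<l)) (≤-trans (m∸n≤m l e) l≤k)
  ... | inj₂ l≤e = subst (1 ≤_) (sym (τ-leaf l≤e)) z<s , subst (_≤ k) (sym (τ-leaf l≤e)) e<k

  module _ {n} (G : Graph n) (c : ProperColouring G) (v : Fin n) where
    open TreeEmbedding G c par par< v

    handle-covered : ∀ {m j} → suc m ≤ l → j ≤ m → Covered m 0 (pred m) j
    handle-covered {m} {j} m<l j≤m with m≤n⇒m<n∨m≡n j≤m
    ... | inj₂ refl = self refl
    handle-covered {suc m} {j} m<l _ | inj₁ (s≤s j≤m) with j ≟ m
    ...   | yes refl = parent z<s (sym (par-handle (<⇒≤ m<l)))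
    ...   | no  j≢m  = listed j (≤∧≢⇒< j≤m j≢m) refl

    leaf-covered : 1 ≤ l → ∀ j → Covered 0 2 (pred l) j
    leaf-covered 1≤l zero = self refl
    leaf-covered 1≤l (suc zero) = child z<s (par-handle 1≤l)
    leaf-covered 1≤l (suc (suc t)) with suc (suc t) ≤? l
    ... | yes j≤l = listed t (pred-mono-≤ j≤l) refl
    ... | no  j≰l = child z<s (par-leaf (≰⇒> j≰l))

    embed : 1 ≤ l → (∀ {u m} → suc m ≤ l → pred m + m < deg G u) →
            (∀ {m} → m < k → pred l + m < deg G v) →
            ∀ m → m ≤ k → ∃ (RainbowEmbedding m)
    embed 1≤l handle centre zero _ = (λ _ → v) , rootOnly
    embed 1≤l handle centre (suc m) m<k with embed 1≤l handle centre m (<⇒≤ m<k)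
    ... | x , E with suc m ≤? l
    ...   | yes m<l = grow E (par-handle m<l) (handle-covered m<l) (handle m<l)
    ...   | no  m≮l = grow E (par-leaf (≰⇒> m≮l)) (λ {j} _ → leaf-covered 1≤l j)
                        (subst (λ u → pred l + m < deg G u) (sym (RainbowEmbedding.root E)) (centre m<k))

    toBroom : l ≤ k → ∀ {x} → RainbowEmbedding k x → RainbowBroom G c k l
    toBroom l≤k {x} E = record
      { f       = x ∘ σ
      ; inj     = λ i j i≤k j≤k eq → σ-injective (injective z≤n z≤n (σ≤k l≤k i≤k) (σ≤k l≤k j≤k) eq)
      ; edges   = λ e e<k → proj₁ (image e<k)
      ; rainbow = λ e e′ e<k e′<k eq →
          let (1≤τe , τe≤k) = τ-range l≤k e<k ; (1≤τe′ , τe′≤k) = τ-range l≤k e′<k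
          in τ-injective (rainbow 1≤τe 1≤τe′ τe≤k τe′≤k
                            (trans (sym (proj₂ (image e<k))) (trans eq (proj₂ (image e′<k)))))
      }
      where
      open RainbowEmbedding E
      image : ∀ {e} → e < k → Adj G (x (σ (broomLo l e))) (x (σ (broomHi e))) ≡ true ×
                               col c (x (σ (broomLo l e))) (x (σ (broomHi e))) ≡ treeColour x (τ e)
      image {e} e<k with broom-edge e | τ-range l≤k e<k
      ... | inj₁ (lo , hi) | 1≤τe , τe≤k rewrite lo | hi =
            adj′ , col-sym c _ _ adj′
            where
            adj′ : Adj G (x (τ e)) (x (par (τ e))) ≡ true
            adj′ = trans (Graph.sym G _ _) (adjacent 1≤τe τe≤k)
      ... | inj₂ (lo , hi) | 1≤τe , τe≤k rewrite lo | hi = adjacent 1≤τe τe≤k , refl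

2*[2+l]∸3 : ∀ l → 2 * (2 + l) ∸ 3 ≡ suc (2 * l)
2*[2+l]∸3 l = trans (cong (_∸ 3) (expand l)) (m+n∸m≡n 3 (suc (2 * l)))
  where
  expand : ∀ l → 2 * (2 + l) ≡ 3 + suc (2 * l)
  expand = solve-∀

-- Placing handle vertex m+1 needs more than pred m + m neighbours at m; this is at most 2l - 3.
handle-arith : ∀ {l m} → suc m ≤ l → pred m + m ≤ 2 * l ∸ 3
handle-arith {m = zero} _ = z≤n
handle-arith {suc (suc l)} {suc m} (s≤s (s≤s m≤l)) = begin
  m + suc m        ≡⟨ +-suc m m ⟩
  suc (m + m)      ≡⟨ cong (λ y → suc (m + y)) (+-identityʳ m) ⟨
  suc (2 * m)      ≤⟨ s≤s (*-monoʳ-≤ 2 m≤l) ⟩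
  suc (2 * l)      ≡⟨ 2*[2+l]∸3 l ⟨
  2 * (2 + l) ∸ 3  ∎
  where open ≤-Reasoning

-- Placing leaf m+1 ≤ k needs more than pred l + m neighbours at the centre; at most k + l - 2.
leaf-arith : ∀ {k l m} → 1 ≤ l → m < k → pred l + m ≤ k + l ∸ 2
leaf-arith {suc k} {suc l} {m} _ (s≤s m≤k) = begin
  l + m                ≤⟨ +-monoʳ-≤ l m≤k ⟩
  l + k                ≡⟨ +-comm l k ⟩
  k + l                ≡⟨ cong (_∸ 1) (+-suc k l) ⟨
  suc k + suc l ∸ 2    ∎
  where open ≤-Reasoning

room : ∀ {k} l → 3 * (2 + l) ≤ k + 3 → 3 * l + 3 ≤ k
room {k} l 3l≤k+3 = +-cancelʳ-≤ 3 (3 * l + 3) k (subst (_≤ k + 3) (expand l) 3l≤k+3)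
  where
  expand : ∀ l → 3 * (2 + l) ≡ (3 * l + 3) + 3
  expand = solve-∀

broom-shape : ∀ {k l} → 1 ≤ k → 1 ≤ l → 3 * l ≤ k + 3 → l ≤ k
broom-shape {l = suc zero} 1≤k _ _ = 1≤k
broom-shape {k} {suc (suc l)} _ _ 3l≤k+3 = ≤-trans (expand l) (room l 3l≤k+3)
  where
  expand : ∀ l → 2 + l ≤ 3 * l + 3
  expand l = subst (_≤ 3 * l + 3) (+-comm l 2) (+-mono-≤ (m≤n*m l 3) (s≤s (s≤s z≤n)))

half-arith : ∀ {k l d} → 1 ≤ l → 3 * l ≤ k + 3 → k + l ∸ 2 < 2 * d → 2 * l ∸ 3 < d
half-arith {d = zero} _ _ ()
half-arith {l = suc zero} {suc d} _ _ _ = z<s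
half-arith {k} {suc (suc l)} {d} _ 3l≤k+3 D<2d = *-cancelˡ-< 2 _ d (begin-strict
  2 * (2 * (2 + l) ∸ 3)   ≡⟨ cong (2 *_) (2*[2+l]∸3 l) ⟩
  2 * suc (2 * l)         ≡⟨ expand l ⟩
  (3 * l + 2) + l         ≤⟨ +-monoˡ-≤ l (≤-trans (n≤1+n _) (subst (_≤ k) (+-suc (3 * l) 2) (room l 3l≤k+3))) ⟩
  k + l                   ≡⟨ +-∸-assoc k {2 + l} {2} (s≤s (s≤s z≤n)) ⟨
  k + (2 + l) ∸ 2         <⟨ D<2d ⟩
  2 * d                   ∎)
  where
  open ≤-Reasoning
  expand : ∀ l → 2 * suc (2 * l) ≡ (3 * l + 2) + l
  expand = solve-∀

rainbowBroom : ∀ {k l} → 1 ≤ l → l ≤ k → ∀ {n} (G : Graph n) (c : ProperColouring G) (v : Fin n) →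
               k + l ∸ 2 < deg G v → (∀ u → 2 * l ∸ 3 < deg G u) → RainbowBroom G c k l
rainbowBroom {k} {l} 1≤l l≤k G c v high low = toBroom G c v l≤k (proj₂ embedding)
  where
  open CentredBroom k l
  open TreeEmbedding G c par par< v using (RainbowEmbedding)
  embedding : ∃ (RainbowEmbedding k)
  embedding = embed G c v 1≤l (λ {u} m<l → ≤-<-trans (handle-arith m<l) (low u))
                              (λ m<k → ≤-<-trans (leaf-arith 1≤l m<k) high) k ≤-refl

lemma4p1 : (k l : ℕ) → 1 ≤ k → 1 ≤ l → 3 * l ≤ k + 3 →
           (n : ℕ) (G : Graph n) (c : ProperColouring G) →
           ¬ RainbowBroom G c k l →
           2 * edgeCount G ≤ (k + l ∸ 2) * n
lemma4p1 k l 1≤k 1≤l 3l≤k+3 n G c noBroom = begin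
  2 * edgeCount G   ≡⟨ handshake G ⟨
  degreeSum G       ≤⟨ degreeSum-bound n G c noBroom ⟩
  (k + l ∸ 2) * n   ∎
  where
  open ≤-Reasoning
  open Degeneracy (λ G c → RainbowBroom G c k l) liftBroom (k + l ∸ 2)
    (λ G c v high low → rainbowBroom 1≤l (broom-shape 1≤k 1≤l 3l≤k+3) G c v high
                                     (λ u → half-arith 1≤l 3l≤k+3 (low u)))
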